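{- Let $n\geq 3$ and let $\mathcal{Q}=\mathcal{Q}_1q\mathcal{Q}_2$ be an admissible path of $l<n$ primes, where $\mathcal{Q}_1,\mathcal{Q}_2$ are nonempty paths and $q$ is a prime. Let $r$ be a free prime for $\mathcal{Q}$. Then: 1. The path $\mathcal{Q}^*=\mathcal{Q}_1r\mathcal{Q}_2$ is admissible if $|r-\ell(\mathcal{Q}_1)|\neq|f(\mathcal{Q}_2)-r|$ and \[\{|r-\ell(\mathcal{Q}_1)|,|f(\mathcal{Q}_2)-r|\}\subset F_g(\mathcal{Q})\cup\{|q-\ell(\mathcal{Q}_1)|,|f(\mathcal{Q}_2)-q|\}.\] 2. The path $\mathcal{Q}^*=\overline{\mathcal{Q}}_1r\mathcal{Q}_2$ is admissible if $|r-f(\mathcal{Q}_1)|\neq|f(\mathcal{Q}_2)-r|$ and \[\{|r-f(\mathcal{Q}_1)|,|f(\mathcal{Q}_2)-r|\}\subset F_g(\mathcal{Q})\cup\{|q-\ell(\mathcal{Q}_1)|,|f(\mathcal{Q}_2)-q|\}.\]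
   Context: Let $p_1=3<p_2=5<p_3=7<\cdots$ be the increasing sequence of odd primes and $\mathbb{P}_n=\{p_1,\dots,p_n\}$. A path of $l$ primes $\mathcal{Q}=q_1q_2\ldots q_l$ is a finite sequence of primes. It is admissible (with respect to the fixed $n$) if the $q_i\in\mathbb{P}_n$ are distinct and the set $E_l$ of the $l-1$ gaps $|q_{i+1}-q_i|$ ($1\le i\le l-1$) is a subset of cardinality $l-1$ of $\{2,4,\ldots,2n-2\}$. A prime of $\mathbb{P}_n$ is free for $\mathcal{Q}$ if it is not among the $q_i$. A gap $2k\le 2n-2$ is free if it is not in $E_l$; $F_g(\mathcal{Q})$ is the set of free gaps. Notation: $\overline{\mathcal{Q}}=q_l\ldots q_1$ is the reversed path; juxtaposition denotes concatenation (single primes such as $q$, $r$ may be inserted, e.g. $\mathcal{Q}_1q\mathcal{Q}_2$); $f(\mathcal{Q})=q_1$, $\ell(\mathcal{Q})=q_l$. -}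

module Defs where

open import Data.Nat using (ℕ; zero; suc; _+_; _*_; _∸_; _≤_; _<_; ∣_-_∣)
open import Data.Nat.Primality using (Prime; prime?)
open import Data.Nat.Divisibility using (_∣_; _∤_; _∣?_)
open import Data.List using (List; []; _∷_; length; filter; upTo)
open import Data.List.NonEmpty using (List⁺; toList; head; last)
open import Data.List.Membership.Propositional using (_∈_; _∉_)
open import Data.List.Relation.Unary.All using (All)
open import Data.List.Relation.Unary.Unique.Propositional using (Unique)
open import Data.Product using (_×_; ∃)
open import Data.Sum using (_⊎_)
open import Relation.Binary.PropositionalEquality using (_≡_)
open import Relation.Nullary using (¬_)
open import Relation.Nullary.Decidable using (_×-dec_; ¬?)

OddPrime : ℕ → Set
OddPrime m = Prime m × 2 ∤ m

oddPrime? : ∀ m → Relation.Nullary.Dec (OddPrime m)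
oddPrime? m = prime? m ×-dec ¬? (2 ∣? m)

-- number of odd primes ≤ m ; the odd prime p is p_k iff oddPrimeCount p ≡ k
oddPrimeCount : ℕ → ℕ
oddPrimeCount m = length (filter oddPrime? (upTo (suc m)))

InP : ℕ → ℕ → Set
InP n p = OddPrime p × oddPrimeCount p ≤ n

gaps : List ℕ → List ℕ
gaps [] = []
gaps (x ∷ []) = []
gaps (x ∷ y ∷ ys) = ∣ y - x ∣ ∷ gaps (y ∷ ys)

EvenGapBound : ℕ → ℕ → Set
EvenGapBound n g = ∃ λ k → g ≡ 2 * k × 1 ≤ k × k ≤ n ∸ 1

-- admissible w.r.t. n: distinct primes of ℙ_n, the l-1 gaps are distinct
-- (so the set E_l has cardinality l-1) and lie in {2,…,2n-2}
Admissible : ℕ → List ℕ → Set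
Admissible n Q = All (InP n) Q × Unique Q × Unique (gaps Q) × All (EvenGapBound n) (gaps Q)

FreePrime : ℕ → List ℕ → ℕ → Set
FreePrime n Q r = InP n r × r ∉ Q

FreeGap : ℕ → List ℕ → ℕ → Set
FreeGap n Q g = EvenGapBound n g × g ∉ gaps Q

f : List⁺ ℕ → ℕ
f = head

ℓ : List⁺ ℕ → ℕ
ℓ = last

module Submission where

-- Write the path as A ++ q ∷ C with A = Q₁, C = Q₂ and let a be the last prime
-- of A, b the first prime of C.  Its gap list then splits as
--   gaps A ++ [ |q-a| , |b-q| ] ++ gaps C          (gaps-junction).
-- The new path is A' ++ r ∷ C, where A' is A itself (part 1) or its reversal
-- (part 2); in both cases A' is a permutation of A and gaps A' of gaps A
-- (gaps-reverse), and A' ends in a' = ℓ Q₁ resp. f Q₁.  Both the vertex list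
-- and the gap list of the new path are thus obtained from the old ones by
-- permuting a prefix and replacing a middle block by new elements, each of
-- which is either recycled from the old middle block or fresh and valid.

open import Defs
open import Data.Nat using (ℕ; _≤_; _<_; ∣_-_∣)
open import Data.List using (List; _∷_; _++_; length)
open import Data.List.NonEmpty using (List⁺; toList; reverse)
open import Data.Product using (_×_)
open import Data.Sum using (_⊎_)
open import Relation.Binary.PropositionalEquality using (_≡_; _≢_)

open import Data.Nat using (suc)
open import Data.Nat.Properties using (∣-∣-comm)
open import Data.List using ([]; _∷ʳ_)
open Data.List using () renaming (reverse to rev)
open import Data.List.Properties using (unfold-reverse)
open import Data.List.NonEmpty as List⁺ using (snocView; _∷ʳ′_)
open import Data.List.Membership.Propositional using (_∈_; _∉_)
open import Data.List.Membership.Propositional.Properties using (∈-++⁺ʳ)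
open import Data.List.Relation.Unary.All as All using (All; []; _∷_)
import Data.List.Relation.Unary.All.Properties as All
open import Data.List.Relation.Unary.Any using (here; there)
open import Data.List.Relation.Unary.AllPairs using ([]; _∷_)
open import Data.List.Relation.Unary.Unique.Propositional using (Unique)
import Data.List.Relation.Unary.Unique.Propositional.Properties as Unique
open import Data.List.Relation.Binary.Disjoint.Propositional using (Disjoint)
open import Data.List.Relation.Binary.Permutation.Propositional
  using (_↭_; ↭-refl; ↭-sym; ↭-trans; ↭-reflexive; ↭⇒↭ₛ)
open import Data.List.Relation.Binary.Permutation.Propositional.Properties
  using (All-resp-↭; ∈-resp-↭; ++⁺ʳ; shifts; ↭-reverse)
import Data.List.Relation.Binary.Permutation.Setoid.Properties as SetoidPermutation
open import Data.Vec as Vec using (Vec)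
import Data.Vec.Properties as Vec
open import Data.Product using (_,_; ∃; proj₁; proj₂)
open import Data.Sum using (inj₁; inj₂)
open import Relation.Binary.PropositionalEquality
  using (refl; sym; trans; cong; cong₂; subst; module ≡-Reasoning)
open import Relation.Binary.PropositionalEquality.Properties using (setoid)

Distinct : (ℕ → Set) → List ℕ → Set
Distinct P xs = All P xs × Unique xs

unique-resp-↭ : ∀ {xs ys : List ℕ} → xs ↭ ys → Unique xs → Unique ys
unique-resp-↭ p = SetoidPermutation.Unique-resp-↭ (setoid ℕ) (↭⇒↭ₛ p)

distinct-resp-↭ : ∀ {P xs ys} → xs ↭ ys → Distinct P xs → Distinct P ys
distinct-resp-↭ p (all , uniq) = All-resp-↭ p all , unique-resp-↭ p uniq

unique-++⁻ : ∀ (xs : List ℕ) {ys} → Unique (xs ++ ys) → Unique ys × Disjoint xs ys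
unique-++⁻ []       uniq           = uniq , λ ()
unique-++⁻ (x ∷ xs) (x∉xs++ys ∷ uniq) with unique-++⁻ xs uniq
... | uniq-ys , disjoint = uniq-ys , λ
  { (here refl , v∈ys) → All.lookup (All.++⁻ʳ xs x∉xs++ys) v∈ys refl
  ; (there v∈xs , v∈ys) → disjoint (v∈xs , v∈ys) }

replace-front : ∀ {P} (M M' D : List ℕ) → Distinct P (M ++ D) → Unique M' →
  (∀ {x} → x ∈ M' → x ∈ M ⊎ (P x × x ∉ M ++ D)) → Distinct P (M' ++ D)
replace-front {P} M M' D (all , uniq) uniq-M' new
  with unique-++⁻ M uniq
... | uniq-D , disjoint-MD =
  All.++⁺ (All.tabulate valid) (All.++⁻ʳ M all) ,
  Unique.++⁺ uniq-M' uniq-D disjoint-M'D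
  where
  valid : ∀ {x} → x ∈ M' → P x
  valid x∈M' with new x∈M'
  ... | inj₁ x∈M         = All.lookup (All.++⁻ˡ M all) x∈M
  ... | inj₂ (px , _)    = px
  disjoint-M'D : Disjoint M' D
  disjoint-M'D (x∈M' , x∈D) with new x∈M'
  ... | inj₁ x∈M         = disjoint-MD (x∈M , x∈D)
  ... | inj₂ (_ , x∉M++D) = x∉M++D (∈-++⁺ʳ M x∈D)

replace-middle : ∀ {P} (A A' M M' C : List ℕ) → Distinct P (A ++ M ++ C) →
  A' ↭ A → Unique M' → (∀ {x} → x ∈ M' → x ∈ M ⊎ (P x × x ∉ A ++ M ++ C)) →
  Distinct P (A' ++ M' ++ C)
replace-middle {P} A A' M M' C dist A'↭A uniq-M' new =
  distinct-resp-↭ (↭-trans (shifts M' A) (++⁺ʳ (M' ++ C) (↭-sym A'↭A)))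
    (replace-front M M' (A ++ C) (distinct-resp-↭ (shifts A M) dist) uniq-M' new')
  where
  new' : ∀ {x} → x ∈ M' → x ∈ M ⊎ (P x × x ∉ M ++ A ++ C)
  new' x∈M' with new x∈M'
  ... | inj₁ x∈M            = inj₁ x∈M
  ... | inj₂ (px , x∉AMC)   = inj₂ (px , λ x∈MAC → x∉AMC (∈-resp-↭ (shifts M A) x∈MAC))

EndsIn : List ℕ → ℕ → Set
EndsIn A a = ∃ λ P → A ≡ P ∷ʳ a

gaps-junction : ∀ {A a} → EndsIn A a → ∀ y ys →
  gaps (A ++ y ∷ ys) ≡ gaps A ++ ∣ y - a ∣ ∷ gaps (y ∷ ys)
gaps-junction (P , refl) = go P
  where
  go : ∀ P {a} y ys → gaps ((P ∷ʳ a) ++ y ∷ ys) ≡ gaps (P ∷ʳ a) ++ ∣ y - a ∣ ∷ gaps (y ∷ ys)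
  go []          y ys = refl
  go (z ∷ [])    y ys = refl
  go (z ∷ w ∷ P) y ys = cong (∣ w - z ∣ ∷_) (go (w ∷ P) y ys)

gaps-reverse : ∀ (xs : List ℕ) → gaps (rev xs) ≡ rev (gaps xs)
gaps-reverse []           = refl
gaps-reverse (x ∷ [])     = refl
gaps-reverse (x ∷ y ∷ ys) = begin
  gaps (rev (x ∷ y ∷ ys))                   ≡⟨ cong gaps (unfold-reverse x (y ∷ ys)) ⟩
  gaps (rev (y ∷ ys) ++ x ∷ [])             ≡⟨ gaps-junction ends x [] ⟩
  gaps (rev (y ∷ ys)) ++ ∣ x - y ∣ ∷ []     ≡⟨ cong₂ (λ g d → g ++ d ∷ []) (gaps-reverse (y ∷ ys)) (∣-∣-comm x y) ⟩
  rev (gaps (y ∷ ys)) ++ ∣ y - x ∣ ∷ []     ≡⟨ sym (unfold-reverse ∣ y - x ∣ (gaps (y ∷ ys))) ⟩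
  rev (gaps (x ∷ y ∷ ys))                   ∎
  where
  open ≡-Reasoning
  ends : EndsIn (rev (y ∷ ys)) y
  ends = rev ys , unfold-reverse y ys

-- A non-empty path ends in its last prime (ℓ is defined through snocView).
ends-last : ∀ (Q : List⁺ ℕ) → EndsIn (toList Q) (ℓ Q)
ends-last Q with snocView Q
... | []       ∷ʳ′ y = [] , refl
... | (x ∷ xs) ∷ʳ′ y = x ∷ xs , refl

-- Non-empty reversal (defined through vectors) agrees with list reversal.
toList-reverse : ∀ (Q : List⁺ ℕ) → toList (reverse Q) ≡ rev (toList Q)
toList-reverse (x List⁺.∷ xs) = begin
  toList (List⁺.fromVec (Vec.reverse v))  ≡⟨ toList-fromVec (Vec.reverse v) ⟩
  Vec.toList (Vec.reverse v)              ≡⟨ Vec.toList-reverse v ⟩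
  rev (x ∷ Vec.toList (Vec.fromList xs))  ≡⟨ cong (λ ys → rev (x ∷ ys)) (Vec.toList∘fromList xs) ⟩
  rev (x ∷ xs)                            ∎
  where
  open ≡-Reasoning
  v = x Vec.∷ Vec.fromList xs
  toList-fromVec : ∀ {m} (w : Vec ℕ (suc m)) → toList (List⁺.fromVec w) ≡ Vec.toList w
  toList-fromVec (y Vec.∷ ys) = refl

ends-reverse : ∀ (Q : List⁺ ℕ) → EndsIn (toList (reverse Q)) (f Q)
ends-reverse Q@(x List⁺.∷ xs) = rev xs , trans (toList-reverse Q) (unfold-reverse x xs)

reverse-↭ : ∀ (Q : List⁺ ℕ) →
  toList (reverse Q) ↭ toList Q × gaps (toList (reverse Q)) ↭ gaps (toList Q)
reverse-↭ Q rewrite toList-reverse Q =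
  ↭-reverse (toList Q) ,
  ↭-trans (↭-reflexive (gaps-reverse (toList Q))) (↭-reverse (gaps (toList Q)))

admissible⁻ : ∀ {n Q} → Admissible n Q → Distinct (InP n) Q × Distinct (EvenGapBound n) (gaps Q)
admissible⁻ (primes , uniq , uniq-gaps , gap-bounds) = (primes , uniq) , (gap-bounds , uniq-gaps)

admissible⁺ : ∀ {n Q} → Distinct (InP n) Q → Distinct (EvenGapBound n) (gaps Q) → Admissible n Q
admissible⁺ (primes , uniq) (gap-bounds , uniq-gaps) = primes , uniq , uniq-gaps , gap-bounds

splice : ∀ n {A A' a a'} q r b B → EndsIn A a → EndsIn A' a' →
  A' ↭ A → gaps A' ↭ gaps A →
  Admissible n (A ++ q ∷ b ∷ B) → FreePrime n (A ++ q ∷ b ∷ B) r →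
  ∣ r - a' ∣ ≢ ∣ b - r ∣ →
  ((x : ℕ) → (x ≡ ∣ r - a' ∣ ⊎ x ≡ ∣ b - r ∣) →
    FreeGap n (A ++ q ∷ b ∷ B) x ⊎ (x ≡ ∣ q - a ∣ ⊎ x ≡ ∣ b - q ∣)) →
  Admissible n (A' ++ r ∷ b ∷ B)
splice n {A} {A'} {a} {a'} q r b B ends ends' A'↭A gaps↭ adm (r∈ℙ , r∉Q) new-gaps≢ new-gaps
  with admissible⁻ adm
... | primes , gaps-Q = admissible⁺ primes' (subst (Distinct (EvenGapBound n)) (sym split') gaps')
  where
  primes' : Distinct (InP n) (A' ++ r ∷ b ∷ B)
  primes' = replace-middle A A' (q ∷ []) (r ∷ []) (b ∷ B) primes A'↭A ([] ∷ [])
    λ { (here refl) → inj₂ (r∈ℙ , r∉Q) }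

  old new : List ℕ
  old = ∣ q - a ∣ ∷ ∣ b - q ∣ ∷ []
  new = ∣ r - a' ∣ ∷ ∣ b - r ∣ ∷ []
  split : gaps (A ++ q ∷ b ∷ B) ≡ gaps A ++ old ++ gaps (b ∷ B)
  split = gaps-junction ends q (b ∷ B)
  split' : gaps (A' ++ r ∷ b ∷ B) ≡ gaps A' ++ new ++ gaps (b ∷ B)
  split' = gaps-junction ends' r (b ∷ B)

  one-of-two : ∀ {x y z} → x ∈ y ∷ z ∷ [] → x ≡ y ⊎ x ≡ z
  one-of-two (here e)         = inj₁ e
  one-of-two (there (here e)) = inj₂ e

  recycled-or-free : ∀ {x} → x ∈ new →
    x ∈ old ⊎ (EvenGapBound n x × x ∉ gaps A ++ old ++ gaps (b ∷ B))
  recycled-or-free {x} x∈new with new-gaps x (one-of-two x∈new)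
  ... | inj₁ (bound , x∉gaps) = inj₂ (bound , λ x∈ → x∉gaps (subst (x ∈_) (sym split) x∈))
  ... | inj₂ (inj₁ e)         = inj₁ (here e)
  ... | inj₂ (inj₂ e)         = inj₁ (there (here e))

  gaps' : Distinct (EvenGapBound n) (gaps A' ++ new ++ gaps (b ∷ B))
  gaps' = replace-middle (gaps A) (gaps A') old new (gaps (b ∷ B))
    (subst (Distinct (EvenGapBound n)) split gaps-Q) gaps↭
    ((new-gaps≢ ∷ []) ∷ [] ∷ []) recycled-or-free

proposition7 : (n : ℕ) → 3 ≤ n → (Q₁ Q₂ : List⁺ ℕ) → (q r : ℕ) →
    Admissible n (toList Q₁ ++ q ∷ toList Q₂) →
    length (toList Q₁ ++ q ∷ toList Q₂) < n →
    FreePrime n (toList Q₁ ++ q ∷ toList Q₂) r →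
    ((∣ r - ℓ Q₁ ∣ ≢ ∣ f Q₂ - r ∣ →
      ((x : ℕ) → (x ≡ ∣ r - ℓ Q₁ ∣ ⊎ x ≡ ∣ f Q₂ - r ∣) →
        FreeGap n (toList Q₁ ++ q ∷ toList Q₂) x ⊎ (x ≡ ∣ q - ℓ Q₁ ∣ ⊎ x ≡ ∣ f Q₂ - q ∣)) →
      Admissible n (toList Q₁ ++ r ∷ toList Q₂))
    ×
    (∣ r - f Q₁ ∣ ≢ ∣ f Q₂ - r ∣ →
      ((x : ℕ) → (x ≡ ∣ r - f Q₁ ∣ ⊎ x ≡ ∣ f Q₂ - r ∣) →
        FreeGap n (toList Q₁ ++ q ∷ toList Q₂) x ⊎ (x ≡ ∣ q - ℓ Q₁ ∣ ⊎ x ≡ ∣ f Q₂ - q ∣)) →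
      Admissible n (toList (reverse Q₁) ++ r ∷ toList Q₂)))
proposition7 n _ Q₁ (b List⁺.∷ B) q r adm _ free =
  splice n q r b B (ends-last Q₁) (ends-last Q₁) ↭-refl ↭-refl adm free ,
  splice n q r b B (ends-last Q₁) (ends-reverse Q₁)
    (proj₁ (reverse-↭ Q₁)) (proj₂ (reverse-↭ Q₁)) adm free
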